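{- For every non-negative integer $d$, with $e=2^d$, and every even $n$ with $0\le n\le 2^e-2$, the vectors $M_dw_n$ and $M_dw_{n+1}$ are complementary: for each $i$, the $i$-th coordinate of $M_dw_n$ is $0$ if and only if the $i$-th coordinate of $M_dw_{n+1}$ is $1$.
   Context: Matrices and vectors are over $\mathbb{F}_2$. Define $M_0=(1)$ and $M_{d+1}=\begin{pmatrix}M_d&M_d\\0&M_d\end{pmatrix}$, so $M_d$ is $2^d\times2^d$. For $e=2^d$, $w_0,\dots,w_{2^e-1}$ are all vectors of $\mathbb{F}_2^e$ in increasing lexicographic order (i.e. $w_n$ is the length-$e$ binary expansion of $n$, first coordinate most significant). -}

module Defs where

open import Data.Bool using (Bool; true; false; _∧_; _xor_)
open import Data.Nat using (ℕ; zero; suc; _+_; _*_; _∸_; _^_; _<_)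
open import Data.Nat.DivMod using (_/_; _%_)
open import Data.Nat.Properties using (+-identityʳ)
open import Data.Fin using (Fin; toℕ; splitAt; cast)
open import Data.Sum using (inj₁; inj₂)

-- F₂ is modelled by Bool: addition = xor, multiplication = ∧, 0 = false, 1 = true.

Matrix : ℕ → ℕ → Set
Matrix m n = Fin m → Fin n → Bool

FVec : ℕ → Set
FVec n = Fin n → Bool

Σ₂ : ∀ {n} → (Fin n → Bool) → Bool
Σ₂ {zero} f = false
Σ₂ {suc n} f = f Fin.zero xor Σ₂ (λ i → f (Fin.suc i))

_·_ : ∀ {m n} → Matrix m n → FVec n → FVec m
(A · v) i = Σ₂ (λ j → A i j ∧ v j)

-- M₀ = (1), M_{d+1} = [[M_d, M_d], [0, M_d]].
-- Note 2 ^ suc d reduces to 2 ^ d + (2 ^ d + 0), so splitAt (2 ^ d) separates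
-- the first block (inj₁) from the second (inj₂).
M : (d : ℕ) → Matrix (2 ^ d) (2 ^ d)
M zero i j = true
M (suc d) i j with splitAt (2 ^ d) i | splitAt (2 ^ d) j
... | inj₁ i' | inj₁ j' = M d i' j'
... | inj₁ i' | inj₂ j' = M d i' (cast (+-identityʳ (2 ^ d)) j')
... | inj₂ i' | inj₁ j' = false
... | inj₂ i' | inj₂ j' = M d (cast (+-identityʳ (2 ^ d)) i') (cast (+-identityʳ (2 ^ d)) j')

-- Length-e binary expansion of n, first coordinate most significant:
-- coordinate i (0-indexed) is bit number (e - 1 - i) of n.
-- bit n k = ⌊ n / 2^k ⌋ mod 2, computed by repeated halving.
bit : ℕ → ℕ → Bool
bit n zero with n % 2
... | zero = false
... | suc _ = true
bit n (suc k) = bit (n / 2) k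

w : (e : ℕ) → ℕ → FVec e
w e n i = bit n (e ∸ suc (toℕ i))

{-# OPTIONS --safe #-}
-- Over F₂ we have w (2k+1) = w (2k) + w 1, and w 1 is the last standard basis
-- vector, so M_d w_{2k+1} = M_d w_{2k} + (last column of M_d).  Every entry of the
-- last column of M_d is 1: by the block recursion it passes through the right
-- column blocks [M_d ; M_d] down to M_0 = (1).  Adding the all-ones vector is
-- complementation.
module Submission where

open import Defs
open import Data.Bool using (Bool; true; false; not; _∧_; _xor_)
open import Data.Bool.Properties
  using (xor-comm; xor-identityʳ; ∧-zeroʳ; ∧-identityʳ; ∧-distribˡ-xor; xor-∧-commutativeRing)
open import Data.Nat using (ℕ; zero; suc; _+_; _*_; _^_; _≤_; _<_; _∸_; z≤n; s≤s)
open import Data.Nat.Properties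
  using (*-comm; +-comm; +-suc; +-identityʳ; +-cancelˡ-≡; m+1+n≰m; m^n>0)
open import Data.Nat.DivMod using (_/_; _%_; m*n%n≡0; m*n/n≡m; [m+kn]%n≡m%n; +-distrib-/)
open import Data.Fin using (Fin; toℕ; fromℕ; splitAt)
open import Data.Fin.Properties
  using (toℕ-fromℕ; toℕ-cast; toℕ<n; toℕ-↑ˡ; toℕ-↑ʳ; splitAt⁻¹-↑ˡ; splitAt⁻¹-↑ʳ)
open import Data.Sum using (inj₁; inj₂)
open import Data.Product using (∃-syntax; _×_; _,_)
open import Data.Empty using (⊥-elim)
open import Algebra.Bundles using (CommutativeRing)
open import Algebra.Properties.CommutativeSemigroup
  (CommutativeRing.+-commutativeSemigroup xor-∧-commutativeRing) using (interchange)
open import Relation.Binary.PropositionalEquality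
  using (_≡_; refl; sym; trans; cong; cong₂; subst; module ≡-Reasoning)
open import Function.Bundles using (_⇔_; mk⇔)

Σ₂-cong : ∀ {n} {f g : Fin n → Bool} → (∀ j → f j ≡ g j) → Σ₂ f ≡ Σ₂ g
Σ₂-cong {zero}  f≗g = refl
Σ₂-cong {suc n} f≗g = cong₂ _xor_ (f≗g Fin.zero) (Σ₂-cong (λ j → f≗g (Fin.suc j)))

Σ₂-xor : ∀ {n} (f g : Fin n → Bool) → Σ₂ (λ j → f j xor g j) ≡ Σ₂ f xor Σ₂ g
Σ₂-xor {zero}  f g = refl
Σ₂-xor {suc n} f g = begin
  (f₀ xor g₀) xor Σ₂ (λ j → f (Fin.suc j) xor g (Fin.suc j))
    ≡⟨ cong ((f₀ xor g₀) xor_) (Σ₂-xor (λ j → f (Fin.suc j)) (λ j → g (Fin.suc j))) ⟩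
  (f₀ xor g₀) xor (Σ₂ (λ j → f (Fin.suc j)) xor Σ₂ (λ j → g (Fin.suc j)))
    ≡⟨ interchange f₀ g₀ _ _ ⟩
  Σ₂ f xor Σ₂ g
    ∎
  where
  open ≡-Reasoning
  f₀ g₀ : Bool
  f₀ = f Fin.zero
  g₀ = g Fin.zero

·-cong : ∀ {m n} (A : Matrix m n) {u v : FVec n} → (∀ j → u j ≡ v j) → ∀ i → (A · u) i ≡ (A · v) i
·-cong A u≗v i = Σ₂-cong (λ j → cong (A i j ∧_) (u≗v j))

·-xor : ∀ {m n} (A : Matrix m n) (u v : FVec n) i →
        (A · (λ j → u j xor v j)) i ≡ (A · u) i xor (A · v) i
·-xor A u v i = trans (Σ₂-cong (λ j → ∧-distribˡ-xor (A i j) (u j) (v j)))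
                      (Σ₂-xor (λ j → A i j ∧ u j) (λ j → A i j ∧ v j))

bit-0 : ∀ k → bit 0 k ≡ false
bit-0 zero    = refl
bit-0 (suc k) = bit-0 k

bit-0-even : ∀ n → n % 2 ≡ 0 → bit n 0 ≡ false
bit-0-even n n%2≡0 with n % 2
bit-0-even n refl | .0 = refl

bit-0-odd : ∀ n → n % 2 ≡ 1 → bit n 0 ≡ true
bit-0-odd n n%2≡1 with n % 2
bit-0-odd n refl | .1 = refl

[2k]%2≡0 : ∀ k → 2 * k % 2 ≡ 0
[2k]%2≡0 k rewrite *-comm 2 k = m*n%n≡0 k 2

[2k+1]%2≡1 : ∀ k → (2 * k + 1) % 2 ≡ 1
[2k+1]%2≡1 k rewrite *-comm 2 k | +-comm (k * 2) 1 = [m+kn]%n≡m%n 1 k 2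

[2k]/2≡k : ∀ k → 2 * k / 2 ≡ k
[2k]/2≡k k rewrite *-comm 2 k = m*n/n≡m k 2

[2k+1]/2≡k : ∀ k → (2 * k + 1) / 2 ≡ k
[2k+1]/2≡k k = begin
  (2 * k + 1) / 2   ≡⟨ +-distrib-/ (2 * k) 1 (subst (λ r → r + 1 < 2) (sym ([2k]%2≡0 k)) (s≤s (s≤s z≤n))) ⟩
  2 * k / 2 + 1 / 2 ≡⟨ cong (_+ 0) ([2k]/2≡k k) ⟩
  k + 0             ≡⟨ +-identityʳ k ⟩
  k                 ∎
  where open ≡-Reasoning

bit-[2k+1] : ∀ k j → bit (2 * k + 1) j ≡ bit (2 * k) j xor bit 1 j
bit-[2k+1] k zero    =
  trans (bit-0-odd (2 * k + 1) ([2k+1]%2≡1 k)) (sym (cong (_xor true) (bit-0-even (2 * k) ([2k]%2≡0 k))))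
bit-[2k+1] k (suc j) rewrite [2k+1]/2≡k k | [2k]/2≡k k | bit-0 j = sym (xor-identityʳ _)

w-[2k+1] : ∀ e k j → w e (2 * k + 1) j ≡ w e (2 * k) j xor w e 1 j
w-[2k+1] e k j = bit-[2k+1] k (e ∸ suc (toℕ j))

·-w-1 : ∀ {m} n (A : Matrix m (suc n)) i → (A · w (suc n) 1) i ≡ A i (fromℕ n)
·-w-1 zero    A i = trans (xor-identityʳ _) (∧-identityʳ _)
·-w-1 (suc n) A i rewrite bit-0 n | ∧-zeroʳ (A i Fin.zero) = ·-w-1 n (λ i j → A i (Fin.suc j)) i

·-w-1-lastColumn : ∀ {m n} (A : Matrix m n) i → 0 < n →
                   (∀ j → suc (toℕ j) ≡ n → A i j ≡ true) → (A · w n 1) i ≡ true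
·-w-1-lastColumn {n = suc n} A i _ lastColumn =
  trans (·-w-1 n A i) (lastColumn (fromℕ n) (cong suc (toℕ-fromℕ n)))

splitAt-last : ∀ m {n} (j : Fin (m + n)) → 0 < n → suc (toℕ j) ≡ m + n →
               ∃[ j′ ] splitAt m j ≡ inj₂ j′ × suc (toℕ j′) ≡ n
splitAt-last m {suc n} j _ last with splitAt m j in split≡
... | inj₁ j′ = ⊥-elim (m+1+n≰m m (subst (_≤ m) last j<m))
  where
  j<m : suc (toℕ j) ≤ m
  j<m = subst (λ k → suc k ≤ m) (trans (sym (toℕ-↑ˡ j′ _)) (cong toℕ (splitAt⁻¹-↑ˡ split≡))) (toℕ<n j′)
... | inj₂ j′ = j′ , refl , +-cancelˡ-≡ m _ _ (begin
  m + suc (toℕ j′) ≡⟨ +-suc m (toℕ j′) ⟩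
  suc (m + toℕ j′) ≡⟨ cong suc (trans (sym (toℕ-↑ʳ m j′)) (cong toℕ (splitAt⁻¹-↑ʳ split≡))) ⟩
  suc (toℕ j)      ≡⟨ last ⟩
  m + suc n        ∎)
  where open ≡-Reasoning

M-lastColumn : ∀ d i j → suc (toℕ j) ≡ 2 ^ d → M d i j ≡ true
M-lastColumn zero    i j _    = refl
M-lastColumn (suc d) i j last
  with j′ , split≡ , last′ ← splitAt-last (2 ^ d) j (subst (0 <_) (sym (+-identityʳ (2 ^ d))) (m^n>0 2 d)) last
  rewrite split≡
  with splitAt (2 ^ d) i
... | inj₁ _ = M-lastColumn d _ _ (trans (cong suc (toℕ-cast _ j′)) (trans last′ (+-identityʳ (2 ^ d))))
... | inj₂ _ = M-lastColumn d _ _ (trans (cong suc (toℕ-cast _ j′)) (trans last′ (+-identityʳ (2 ^ d))))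

M·w-1 : ∀ d i → (M d · w (2 ^ d) 1) i ≡ true
M·w-1 d i = ·-w-1-lastColumn (M d) i (m^n>0 2 d) (M-lastColumn d i)

M·w-[2k+1] : ∀ d k i → (M d · w (2 ^ d) (2 * k + 1)) i ≡ not ((M d · w (2 ^ d) (2 * k)) i)
M·w-[2k+1] d k i = begin
  (M d · w e (2 * k + 1)) i                   ≡⟨ ·-cong (M d) (w-[2k+1] e k) i ⟩
  (M d · (λ j → w e (2 * k) j xor w e 1 j)) i ≡⟨ ·-xor (M d) (w e (2 * k)) (w e 1) i ⟩
  (M d · w e (2 * k)) i xor (M d · w e 1) i   ≡⟨ cong ((M d · w e (2 * k)) i xor_) (M·w-1 d i) ⟩
  (M d · w e (2 * k)) i xor true              ≡⟨ xor-comm _ true ⟩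
  not ((M d · w e (2 * k)) i)                 ∎
  where
  open ≡-Reasoning
  e : ℕ
  e = 2 ^ d

≡false⇔not≡true : ∀ {b} → (b ≡ false) ⇔ (not b ≡ true)
≡false⇔not≡true {false} = mk⇔ (λ _ → refl) (λ _ → refl)
≡false⇔not≡true {true}  = mk⇔ (λ ()) (λ ())

lemma3 : (d k : ℕ) → 2 * k ≤ 2 ^ (2 ^ d) ∸ 2 → (i : Fin (2 ^ d)) →
    ((M d · w (2 ^ d) (2 * k)) i ≡ false) ⇔ ((M d · w (2 ^ d) (2 * k + 1)) i ≡ true)
lemma3 d k _ i rewrite M·w-[2k+1] d k i = ≡false⇔not≡true
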